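{- Let $\varphi$ be an LTL formula with basis $B$, and let $\mathbf G\mathbf F\psi\in B$. For every $C\subseteq B_{\prec\mathbf G\mathbf F\psi}$: the formula $\mathbf G\mathbf F(\psi\langle C\rangle_\mu)$ belongs to $\Delta_2$; the formulas $\mathbf G\mathbf F\psi$ and $\mathbf G\mathbf F(\psi\langle C\rangle_\mu)$ are equivalent under the context $\langle C,B_{\prec\mathbf G\mathbf F\psi}\rangle$; and for every $C'$ with $C\subseteq C'\subseteq B_{\prec\mathbf G\mathbf F\psi}$ we have $\mathbf G\mathbf F(\psi\langle C\rangle_\mu)\models\mathbf G\mathbf F(\psi\langle C'\rangle_\mu)$.
   Context: LTL formulas over a finite set $Ap$ are in negation normal form, generated by $\mathbf{tt},\mathbf{ff},a,\overline a$ ($a\in Ap$), $\wedge,\vee,\mathbf X,\mathbf U,\mathbf W,\mathbf R,\mathbf M$, with standard semantics on infinite words over $2^{Ap}$ ($w_i$ suffix from position $i$; $\varphi\mathbf U\psi$: $\exists k.\,w_k\models\psi\wedge\forall j<k.\,w_j\models\varphi$; $\varphi\mathbf M\psi$: $\exists k.\,w_k\models\varphi\wedge\forall j\le k.\,w_j\models\psi$; $\varphi\mathbf R\psi$: $\forall k.\,w_k\models\psi$ or $\varphi\mathbf M\psi$; $\varphi\mathbf W\psi$: $\forall k.\,w_k\models\varphi$ or $\varphi\mathbf U\psi$); $\mathbf F\varphi=\mathbf{tt}\mathbf U\varphi$, $\mathbf G\varphi=\varphi\mathbf W\mathbf{ff}$; $\varphi\models\psi$ means every model of $\varphi$ is a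 model of $\psi$. Hierarchy: $\Sigma_0=\Pi_0=\Delta_0$ least set containing $\mathbf{tt},\mathbf{ff},a,\overline a$ closed under $\wedge,\vee$; $\Sigma_{i+1}$ least set containing $\Pi_i$ closed under $\wedge,\vee,\mathbf X,\mathbf U,\mathbf M$; $\Pi_{i+1}$ least set containing $\Sigma_i$ closed under $\wedge,\vee,\mathbf X,\mathbf R,\mathbf W$; $\Delta_{i+1}$ least set containing $\Sigma_{i+1}\cup\Pi_{i+1}$ closed under $\wedge,\vee$. Context: for a finite set $S$ of formulas and $C\subseteq S$, $\mathcal L\langle C,S\rangle$ is the set of words satisfying every formula of $C$ and none of $S\setminus C$; two formulas are equivalent under $\langle C,S\rangle$ if they agree on all words of $\mathcal L\langle C,S\rangle$. Basis of $\varphi$: $B=B_{\mathbf{GF}}\cup B_{\mathbf{FG}}$ with $B_{\mathbf{GF}}=\{\mathbf G\mathbf F\psi\mid\exists\chi.\,\chi\mathbf U\psi\in sf(\varphi)\text{ or }\psi\mathbf M\chi\in sf(\varphi)\}$, $B_{\mathbf{FG}}=\{\mathbf F\mathbf G\psi\mid\exists\chi.\,\psi\mathbf W\chi\in sf(\varphi)\text{ or }\chi\mathbf R\psi\in sf(\varphi)\}$. Order: $op(\psi)\prec op'(\psi')$ (for $op,op'\in\{\mathbf G\mathbf F,\mathbf F\mathbf G\}$) iff $\psi$ is a proper subformula of $\psi'$; $B_{\prec\chi}=\{\chi'\in B\mid\chi'\prec\chi\}$. $\psi\langle C\rangle_\mu$: equals $\psi$ for $\mathbf{tt},\mathbf{ff},a,\overline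 a$; homomorphic for $\wedge,\vee,\mathbf X,\mathbf U,\mathbf M$; $(\psi_1\mathbf W\psi_2)\langle C\rangle_\mu=\psi_1\langle C\rangle_\mu\mathbf U\psi_2\langle C\rangle_\mu$ if $\mathbf F\mathbf G\psi_1\notin C$, else $\mathbf{tt}$; $(\psi_1\mathbf R\psi_2)\langle C\rangle_\mu=\psi_1\langle C\rangle_\mu\mathbf M\psi_2\langle C\rangle_\mu$ if $\mathbf F\mathbf G\psi_2\notin C$, else $\mathbf{tt}$. (This is the paper's dual definition $\overline{\overline\psi\langle C_d\rangle_\nu}$ written out.) -}

module Defs where

open import Data.Nat using (ℕ; zero; suc; _+_; _<_)
open import Data.Fin using (Fin)
open import Data.Fin.Subset using (Subset; _∈_; _∉_)
open import Data.Bool using (Bool; true; false; if_then_else_)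
open import Data.Product using (Σ; _×_; _,_)
open import Data.Sum using (_⊎_)
open import Data.Unit using (⊤)
open import Data.Empty using (⊥)
open import Relation.Nullary using (¬_)
open import Relation.Binary.PropositionalEquality using (_≡_)

data Formula (n : ℕ) : Set where
  tt ff      : Formula n
  var nvar   : Fin n → Formula n
  _∧_ _∨_    : Formula n → Formula n → Formula n
  X          : Formula n → Formula n
  _U_ _W_ _R_ _M_ : Formula n → Formula n → Formula n

infixr 5 _∧_ _∨_
infixr 6 _U_ _W_ _R_ _M_

module _ {n : ℕ} where

  F G : Formula n → Formula n
  F φ = tt U φ
  G φ = φ W ff

  GF FG : Formula n → Formula n
  GF φ = G (F φ)
  FG φ = F (G φ)

Word : ℕ → Set
Word n = ℕ → Subset n

suffix : ∀ {n} → ℕ → Word n → Word n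
suffix i w k = w (i + k)

_⊨_ : ∀ {n} → Word n → Formula n → Set
w ⊨ tt = ⊤
w ⊨ ff = ⊥
w ⊨ var a = a ∈ w 0
w ⊨ nvar a = a ∉ w 0
w ⊨ (φ ∧ ψ) = (w ⊨ φ) × (w ⊨ ψ)
w ⊨ (φ ∨ ψ) = (w ⊨ φ) ⊎ (w ⊨ ψ)
w ⊨ X φ = suffix 1 w ⊨ φ
w ⊨ (φ U ψ) = Σ ℕ λ k → (suffix k w ⊨ ψ) × (∀ j → j < k → suffix j w ⊨ φ)
w ⊨ (φ M ψ) = Σ ℕ λ k → (suffix k w ⊨ φ) × (∀ j → j < k → suffix j w ⊨ ψ) × (suffix k w ⊨ ψ)
w ⊨ (φ R ψ) = (∀ k → suffix k w ⊨ ψ) ⊎ (Σ ℕ λ k → (suffix k w ⊨ φ) × (∀ j → j < k → suffix j w ⊨ ψ) × (suffix k w ⊨ ψ))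
w ⊨ (φ W ψ) = (∀ k → suffix k w ⊨ φ) ⊎ (Σ ℕ λ k → (suffix k w ⊨ ψ) × (∀ j → j < k → suffix j w ⊨ φ))

_⊨ᶠ_ : ∀ {n} → Formula n → Formula n → Set
φ ⊨ᶠ ψ = ∀ w → w ⊨ φ → w ⊨ ψ

data Child {n} : Formula n → Formula n → Set where
  ∧ˡ : ∀ {a b} → Child a (a ∧ b)
  ∧ʳ : ∀ {a b} → Child b (a ∧ b)
  ∨ˡ : ∀ {a b} → Child a (a ∨ b)
  ∨ʳ : ∀ {a b} → Child b (a ∨ b)
  Xc : ∀ {a} → Child a (X a)
  Uˡ : ∀ {a b} → Child a (a U b)
  Uʳ : ∀ {a b} → Child b (a U b)
  Wˡ : ∀ {a b} → Child a (a W b)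
  Wʳ : ∀ {a b} → Child b (a W b)
  Rˡ : ∀ {a b} → Child a (a R b)
  Rʳ : ∀ {a b} → Child b (a R b)
  Mˡ : ∀ {a b} → Child a (a M b)
  Mʳ : ∀ {a b} → Child b (a M b)

data _∈sf_ {n} : Formula n → Formula n → Set where
  here : ∀ {φ} → φ ∈sf φ
  there : ∀ {ψ χ φ} → ψ ∈sf χ → Child χ φ → ψ ∈sf φ

data _⊏_ {n} : Formula n → Formula n → Set where
  proper : ∀ {ψ χ φ} → ψ ∈sf χ → Child χ φ → ψ ⊏ φ

data InBasis {n} (φ : Formula n) : Formula n → Set where
  gfU : ∀ {χ ψ} → (χ U ψ) ∈sf φ → InBasis φ (GF ψ)
  gfM : ∀ {χ ψ} → (ψ M χ) ∈sf φ → InBasis φ (GF ψ)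
  fgW : ∀ {χ ψ} → (ψ W χ) ∈sf φ → InBasis φ (FG ψ)
  fgR : ∀ {χ ψ} → (χ R ψ) ∈sf φ → InBasis φ (FG ψ)

data _≺_ {n} : Formula n → Formula n → Set where
  gf≺gf : ∀ {ψ ψ'} → ψ ⊏ ψ' → GF ψ ≺ GF ψ'
  gf≺fg : ∀ {ψ ψ'} → ψ ⊏ ψ' → GF ψ ≺ FG ψ'
  fg≺gf : ∀ {ψ ψ'} → ψ ⊏ ψ' → FG ψ ≺ GF ψ'
  fg≺fg : ∀ {ψ ψ'} → ψ ⊏ ψ' → FG ψ ≺ FG ψ'

Below : ∀ {n} → Formula n → Formula n → Formula n → Set
Below φ χ χ' = InBasis φ χ' × (χ' ≺ χ)

-- Sets C of formulas are given by characteristic functions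
_⊆ᵇ_ : ∀ {n} → (Formula n → Bool) → (Formula n → Set) → Set
C ⊆ᵇ S = ∀ χ → C χ ≡ true → S χ

_⊆ᵇᵇ_ : ∀ {n} → (Formula n → Bool) → (Formula n → Bool) → Set
C ⊆ᵇᵇ C' = ∀ χ → C χ ≡ true → C' χ ≡ true

InContext : ∀ {n} → (Formula n → Bool) → (Formula n → Set) → Word n → Set
InContext C S w =
  (∀ χ → C χ ≡ true → w ⊨ χ) × (∀ χ → S χ → C χ ≡ false → ¬ (w ⊨ χ))

EquivUnder : ∀ {n} → (Formula n → Bool) → (Formula n → Set) → Formula n → Formula n → Set
EquivUnder C S φ ψ = ∀ w → InContext C S w → ((w ⊨ φ) → (w ⊨ ψ)) × ((w ⊨ ψ) → (w ⊨ φ))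

μ⟨_⟩ : ∀ {n} → (Formula n → Bool) → Formula n → Formula n
μ⟨ C ⟩ tt = tt
μ⟨ C ⟩ ff = ff
μ⟨ C ⟩ (var a) = var a
μ⟨ C ⟩ (nvar a) = nvar a
μ⟨ C ⟩ (a ∧ b) = μ⟨ C ⟩ a ∧ μ⟨ C ⟩ b
μ⟨ C ⟩ (a ∨ b) = μ⟨ C ⟩ a ∨ μ⟨ C ⟩ b
μ⟨ C ⟩ (X a) = X (μ⟨ C ⟩ a)
μ⟨ C ⟩ (a U b) = μ⟨ C ⟩ a U μ⟨ C ⟩ b
μ⟨ C ⟩ (a M b) = μ⟨ C ⟩ a M μ⟨ C ⟩ b
μ⟨ C ⟩ (a W b) = if C (FG a) then tt else (μ⟨ C ⟩ a U μ⟨ C ⟩ b)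
μ⟨ C ⟩ (a R b) = if C (FG b) then tt else (μ⟨ C ⟩ a M μ⟨ C ⟩ b)

data Base {n} : Formula n → Set where
  tt : Base tt
  ff : Base ff
  var : ∀ a → Base (var a)
  nvar : ∀ a → Base (nvar a)
  _∧_ : ∀ {a b} → Base a → Base b → Base (a ∧ b)
  _∨_ : ∀ {a b} → Base a → Base b → Base (a ∨ b)

data Σₕ {n} : ℕ → Formula n → Set
data Πₕ {n} : ℕ → Formula n → Set

data Σₕ {n} where
  base : ∀ {a} → Base a → Σₕ zero a
  fromΠ : ∀ {i a} → Πₕ i a → Σₕ (suc i) a
  _∧_ : ∀ {i a b} → Σₕ (suc i) a → Σₕ (suc i) b → Σₕ (suc i) (a ∧ b)
  _∨_ : ∀ {i a b} → Σₕ (suc i) a → Σₕ (suc i) b → Σₕ (suc i) (a ∨ b)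
  X : ∀ {i a} → Σₕ (suc i) a → Σₕ (suc i) (X a)
  _U_ : ∀ {i a b} → Σₕ (suc i) a → Σₕ (suc i) b → Σₕ (suc i) (a U b)
  _M_ : ∀ {i a b} → Σₕ (suc i) a → Σₕ (suc i) b → Σₕ (suc i) (a M b)

data Πₕ {n} where
  base : ∀ {a} → Base a → Πₕ zero a
  fromΣ : ∀ {i a} → Σₕ i a → Πₕ (suc i) a
  _∧_ : ∀ {i a b} → Πₕ (suc i) a → Πₕ (suc i) b → Πₕ (suc i) (a ∧ b)
  _∨_ : ∀ {i a b} → Πₕ (suc i) a → Πₕ (suc i) b → Πₕ (suc i) (a ∨ b)
  X : ∀ {i a} → Πₕ (suc i) a → Πₕ (suc i) (X a)
  _R_ : ∀ {i a b} → Πₕ (suc i) a → Πₕ (suc i) b → Πₕ (suc i) (a R b)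
  _W_ : ∀ {i a b} → Πₕ (suc i) a → Πₕ (suc i) b → Πₕ (suc i) (a W b)

data Δₕ {n} : ℕ → Formula n → Set where
  base : ∀ {a} → Base a → Δₕ zero a
  fromΣ : ∀ {i a} → Σₕ (suc i) a → Δₕ (suc i) a
  fromΠ : ∀ {i a} → Πₕ (suc i) a → Δₕ (suc i) a
  _∧_ : ∀ {i a b} → Δₕ (suc i) a → Δₕ (suc i) b → Δₕ (suc i) (a ∧ b)
  _∨_ : ∀ {i a b} → Δₕ (suc i) a → Δₕ (suc i) b → Δₕ (suc i) (a ∨ b)

{-# OPTIONS --safe #-}
module Submission where

-- On a word of L⟨C, B≺GFψ⟩, C records exactly which FG α of the basis below GF ψ hold. If FG α
-- holds, every late enough suffix satisfies G α, hence α W β, so that subformula is eventually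
-- equivalent to tt; if it fails, no suffix satisfies G α, so α W β agrees with α U β on every suffix
-- (dually for R and M). By induction, ψ and ψ⟨C⟩μ agree on all late enough suffixes, which GF
-- cannot tell apart. The translation leaves only U, M and tt, so it lands in Σ₁, and enlarging C
-- only replaces more subformulas by tt.

open import Defs
open import Data.Nat using (ℕ; _+_; _∸_; _≤_; _⊔_)
open import Data.Nat.Properties using (+-assoc; m≤m+n; m≤n+m; m+[n∸m]≡n; m≤m⊔n; m≤n⊔m; ≤-trans)
open import Data.Product using (_×_; _,_; ∃; proj₁; proj₂)
open import Data.Sum using (inj₁; inj₂)
open import Data.Bool using (Bool; true; false)
open import Data.Empty using (⊥-elim)
open import Data.Fin.Subset using (_∈_; _∉_)
open import Function using (id; _∘′_)
open import Relation.Nullary using (¬_)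
open import Relation.Binary.PropositionalEquality
  using (_≡_; sym; trans; cong; subst; _≗_)
open import Level using (0ℓ)
open import Axiom.ExcludedMiddle using (ExcludedMiddle)

suffix-suffix : ∀ {n} (w : Word n) i j → suffix j (suffix i w) ≗ suffix (i + j) w
suffix-suffix w i j t = cong w (sym (+-assoc i j t))

suffix-resp-≗ : ∀ {n} {w w' : Word n} k → w ≗ w' → suffix k w ≗ suffix k w'
suffix-resp-≗ k e t = e (k + t)

⊨-resp-≗ : ∀ {n} (χ : Formula n) {w w' : Word n} → w ≗ w' → w ⊨ χ → w' ⊨ χ
⊨-resp-≗ tt e h = h
⊨-resp-≗ ff e ()
⊨-resp-≗ (var a) e h = subst (a ∈_) (e 0) h
⊨-resp-≗ (nvar a) e h = subst (a ∉_) (e 0) h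
⊨-resp-≗ (a ∧ b) e (x , y) = ⊨-resp-≗ a e x , ⊨-resp-≗ b e y
⊨-resp-≗ (a ∨ b) e (inj₁ x) = inj₁ (⊨-resp-≗ a e x)
⊨-resp-≗ (a ∨ b) e (inj₂ y) = inj₂ (⊨-resp-≗ b e y)
⊨-resp-≗ (X a) e h = ⊨-resp-≗ a (suffix-resp-≗ 1 e) h
⊨-resp-≗ (a U b) e (k , x , y) =
  k , ⊨-resp-≗ b (suffix-resp-≗ k e) x , λ j j<k → ⊨-resp-≗ a (suffix-resp-≗ j e) (y j j<k)
⊨-resp-≗ (a M b) e (k , x , y , z) =
  k , ⊨-resp-≗ a (suffix-resp-≗ k e) x , (λ j j<k → ⊨-resp-≗ b (suffix-resp-≗ j e) (y j j<k)) ,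
  ⊨-resp-≗ b (suffix-resp-≗ k e) z
⊨-resp-≗ (a R b) e (inj₁ h) = inj₁ λ k → ⊨-resp-≗ b (suffix-resp-≗ k e) (h k)
⊨-resp-≗ (a R b) e (inj₂ m) = inj₂ (⊨-resp-≗ (a M b) e m)
⊨-resp-≗ (a W b) e (inj₁ h) = inj₁ λ k → ⊨-resp-≗ a (suffix-resp-≗ k e) (h k)
⊨-resp-≗ (a W b) e (inj₂ u) = inj₂ (⊨-resp-≗ (a U b) e u)

G-suffix : ∀ {n} {a : Formula n} {w : Word n} → w ⊨ G a → ∀ j → suffix j w ⊨ G a
G-suffix {a = a} {w} (inj₁ h) j = inj₁ λ m → ⊨-resp-≗ a (λ t → sym (suffix-suffix w j m t)) (h (j + m))

G⊨W : ∀ {n} {a b : Formula n} → G a ⊨ᶠ (a W b)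
G⊨W w (inj₁ h) = inj₁ h

G⊨R : ∀ {n} {a b : Formula n} → G b ⊨ᶠ (a R b)
G⊨R w (inj₁ h) = inj₁ h

∈sf-trans : ∀ {n} {a b c : Formula n} → a ∈sf b → b ∈sf c → a ∈sf c
∈sf-trans p here = p
∈sf-trans p (there q c) = there (∈sf-trans p q) c

child-⊏ : ∀ {n} {a χ ψ : Formula n} → Child a χ → χ ∈sf ψ → a ⊏ ψ
child-⊏ c here = proper here c
child-⊏ c (there p c') = proper (∈sf-trans (there here c) p) c'

InBasis-mono : ∀ {n} {χ χ' β : Formula n} → χ ∈sf χ' → InBasis χ β → InBasis χ' β
InBasis-mono p (gfU q) = gfU (∈sf-trans q p)
InBasis-mono p (gfM q) = gfM (∈sf-trans q p)
InBasis-mono p (fgW q) = fgW (∈sf-trans q p)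
InBasis-mono p (fgR q) = fgR (∈sf-trans q p)

GF-basis-∈sf : ∀ {n} {φ ψ : Formula n} → InBasis φ (GF ψ) → ψ ∈sf φ
GF-basis-∈sf (gfU p) = ∈sf-trans (there here Uʳ) p
GF-basis-∈sf (gfM p) = ∈sf-trans (there here Mˡ) p

FG-basis-⊏ : ∀ {n} {ψ a : Formula n} → InBasis ψ (FG a) → a ⊏ ψ
FG-basis-⊏ (fgW p) = child-⊏ Wˡ p
FG-basis-⊏ (fgR p) = child-⊏ Rʳ p

FG-basis-below : ∀ {n} {φ ψ a : Formula n} → ψ ∈sf φ → InBasis ψ (FG a) → Below φ (GF ψ) (FG a)
FG-basis-below p β = InBasis-mono p β , fg≺gf (FG-basis-⊏ β)

μ-Σ₁ : ∀ {n} (C : Formula n → Bool) (χ : Formula n) → Σₕ 1 (μ⟨ C ⟩ χ)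
μ-Σ₁ C tt = fromΠ (base tt)
μ-Σ₁ C ff = fromΠ (base ff)
μ-Σ₁ C (var a) = fromΠ (base (var a))
μ-Σ₁ C (nvar a) = fromΠ (base (nvar a))
μ-Σ₁ C (a ∧ b) = μ-Σ₁ C a ∧ μ-Σ₁ C b
μ-Σ₁ C (a ∨ b) = μ-Σ₁ C a ∨ μ-Σ₁ C b
μ-Σ₁ C (X a) = X (μ-Σ₁ C a)
μ-Σ₁ C (a U b) = μ-Σ₁ C a U μ-Σ₁ C b
μ-Σ₁ C (a M b) = μ-Σ₁ C a M μ-Σ₁ C b
μ-Σ₁ C (a W b) with C (FG a)
... | true = fromΠ (base tt)
... | false = μ-Σ₁ C a U μ-Σ₁ C b
μ-Σ₁ C (a R b) with C (FG b)
... | true = fromΠ (base tt)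
... | false = μ-Σ₁ C a M μ-Σ₁ C b

GF-Σ₁-Δ₂ : ∀ {n} {χ : Formula n} → Σₕ 1 χ → Δₕ 2 (GF χ)
GF-Σ₁-Δ₂ s = fromΠ (fromΣ (fromΠ (base tt) U s) W fromΣ (fromΠ (base ff)))

Decides : ∀ {n} → (Formula n → Bool) → Word n → Formula n → Set
Decides C w χ = (C χ ≡ true → w ⊨ χ) × (C χ ≡ false → ¬ (w ⊨ χ))

InContext-decides : ∀ {n} {C : Formula n → Bool} {S w χ} → InContext C S w → S χ → Decides C w χ
InContext-decides (pos , neg) s = pos _ , neg _ s

module Eventually {n : ℕ} (w : Word n) where

  -- Words are compared up to ≗ because suffix j (suffix i w) is not definitionally suffix (i + j) w.
  record _⇛[_]_ (x : Formula n) (i₀ : ℕ) (y : Formula n) : Set where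
    constructor late
    field apply : ∀ {i w'} → i₀ ≤ i → w' ≗ suffix i w → w' ⊨ x → w' ⊨ y

  open _⇛[_]_

  _≈_ : Formula n → Formula n → Set
  x ≈ y = ∃ λ i₀ → x ⇛[ i₀ ] y × y ⇛[ i₀ ] x

  ⇛-refl : ∀ {x i₀} → x ⇛[ i₀ ] x
  ⇛-refl = late λ _ _ → id

  ⇛-weaken : ∀ {x y i₀ i₁} → i₀ ≤ i₁ → x ⇛[ i₀ ] y → x ⇛[ i₁ ] y
  ⇛-weaken i₀≤i₁ (late q) = late λ h → q (≤-trans i₀≤i₁ h)

  ⇛-trans : ∀ {x y z i₀} → x ⇛[ i₀ ] y → y ⇛[ i₀ ] z → x ⇛[ i₀ ] z
  ⇛-trans (late p) (late q) = late λ h e → q h e ∘′ p h e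

  ⇛-tt : ∀ {x i₀} → x ⇛[ i₀ ] tt
  ⇛-tt = late λ _ _ _ → _

  ⊨ᶠ⇒⇛ : ∀ {x y i₀} → x ⊨ᶠ y → x ⇛[ i₀ ] y
  ⊨ᶠ⇒⇛ x⊨y = late λ _ _ → x⊨y _

  ⇛-suffix : ∀ {x y i₀ i w'} → x ⇛[ i₀ ] y → i₀ ≤ i → w' ≗ suffix i w →
             ∀ k → suffix k w' ⊨ x → suffix k w' ⊨ y
  ⇛-suffix {i = i} (late q) h e k =
    q (≤-trans h (m≤m+n i k)) λ t → trans (e (k + t)) (suffix-suffix w i k t)

  ∧-⇛ : ∀ {a a' b b' i₀} → a ⇛[ i₀ ] a' → b ⇛[ i₀ ] b' → (a ∧ b) ⇛[ i₀ ] (a' ∧ b')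
  ∧-⇛ (late qa) (late qb) = late λ { h e (x , y) → qa h e x , qb h e y }

  ∨-⇛ : ∀ {a a' b b' i₀} → a ⇛[ i₀ ] a' → b ⇛[ i₀ ] b' → (a ∨ b) ⇛[ i₀ ] (a' ∨ b')
  ∨-⇛ (late qa) (late qb) = late λ { h e (inj₁ x) → inj₁ (qa h e x) ; h e (inj₂ y) → inj₂ (qb h e y) }

  X-⇛ : ∀ {a a' i₀} → a ⇛[ i₀ ] a' → X a ⇛[ i₀ ] X a'
  X-⇛ qa = late λ h e → ⇛-suffix qa h e 1

  U-⇛ : ∀ {a a' b b' i₀} → a ⇛[ i₀ ] a' → b ⇛[ i₀ ] b' → (a U b) ⇛[ i₀ ] (a' U b')
  U-⇛ qa qb = late λ { h e (k , x , y) →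
    k , ⇛-suffix qb h e k x , λ j j<k → ⇛-suffix qa h e j (y j j<k) }

  M-⇛ : ∀ {a a' b b' i₀} → a ⇛[ i₀ ] a' → b ⇛[ i₀ ] b' → (a M b) ⇛[ i₀ ] (a' M b')
  M-⇛ qa qb = late λ { h e (k , x , y , z) →
    k , ⇛-suffix qa h e k x , (λ j j<k → ⇛-suffix qb h e j (y j j<k)) , ⇛-suffix qb h e k z }

  U⇛W : ∀ {a a' b b' i₀} → a ⇛[ i₀ ] a' → b ⇛[ i₀ ] b' → (a U b) ⇛[ i₀ ] (a' W b')
  U⇛W qa qb = late λ h e u → inj₂ (apply (U-⇛ qa qb) h e u)

  M⇛R : ∀ {a a' b b' i₀} → a ⇛[ i₀ ] a' → b ⇛[ i₀ ] b' → (a M b) ⇛[ i₀ ] (a' R b')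
  M⇛R qa qb = late λ h e m → inj₂ (apply (M-⇛ qa qb) h e m)

  G-at-suffix⇒FG : ∀ {a i w'} → w' ≗ suffix i w → w' ⊨ G a → w ⊨ FG a
  G-at-suffix⇒FG {a} {i} e g = i , ⊨-resp-≗ (G a) e g , λ _ _ → _

  W⇛U : ∀ {a a' b b' i₀} → ¬ (w ⊨ FG a) → a ⇛[ i₀ ] a' → b ⇛[ i₀ ] b' → (a W b) ⇛[ i₀ ] (a' U b')
  W⇛U {a} ¬FGa qa qb = late λ
    { h e (inj₁ always) → ⊥-elim (¬FGa (G-at-suffix⇒FG {a} e (inj₁ always)))
    ; h e (inj₂ u) → apply (U-⇛ qa qb) h e u }

  R⇛M : ∀ {a a' b b' i₀} → ¬ (w ⊨ FG b) → a ⇛[ i₀ ] a' → b ⇛[ i₀ ] b' → (a R b) ⇛[ i₀ ] (a' M b')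
  R⇛M {b = b} ¬FGb qa qb = late λ
    { h e (inj₁ always) → ⊥-elim (¬FGb (G-at-suffix⇒FG {b} e (inj₁ always)))
    ; h e (inj₂ m) → apply (M-⇛ qa qb) h e m }

  FG⇒eventually-G : ∀ {a} → w ⊨ FG a → ∃ λ i₀ → tt ⇛[ i₀ ] G a
  FG⇒eventually-G {a} (k , g , _) = k , late λ {i} h e _ →
    ⊨-resp-≗ (G a) (λ t → sym (e t))
      (subst (λ j → suffix j w ⊨ G a) (m+[n∸m]≡n h)
        (⊨-resp-≗ (G a) (suffix-suffix w k (i ∸ k)) (G-suffix {a = a} {suffix k w} g (i ∸ k))))

  FG-entails⇒≈tt : ∀ {a χ} → w ⊨ FG a → G a ⊨ᶠ χ → χ ≈ tt
  FG-entails⇒≈tt {a} FGa Ga⊨χ with FG⇒eventually-G {a} FGa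
  ... | i₀ , eventually-G = i₀ , ⇛-tt , ⇛-trans eventually-G (⊨ᶠ⇒⇛ Ga⊨χ)

  ≈-refl : ∀ {x} → x ≈ x
  ≈-refl = 0 , ⇛-refl , ⇛-refl

  ≈-cong₁ : ∀ {a a' c c'} →
            (∀ {i₀} → a ⇛[ i₀ ] a' → c ⇛[ i₀ ] c') → (∀ {i₀} → a' ⇛[ i₀ ] a → c' ⇛[ i₀ ] c) →
            a ≈ a' → c ≈ c'
  ≈-cong₁ f g (i₀ , p , p') = i₀ , f p , g p'

  ≈-cong₂ : ∀ {a a' b b' c c'} →
            (∀ {i₀} → a ⇛[ i₀ ] a' → b ⇛[ i₀ ] b' → c ⇛[ i₀ ] c') →
            (∀ {i₀} → a' ⇛[ i₀ ] a → b' ⇛[ i₀ ] b → c' ⇛[ i₀ ] c) →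
            a ≈ a' → b ≈ b' → c ≈ c'
  ≈-cong₂ f g (i , p , p') (j , q , q') =
    i ⊔ j , f (⇛-weaken (m≤m⊔n i j) p) (⇛-weaken (m≤n⊔m i j) q)
          , g (⇛-weaken (m≤m⊔n i j) p') (⇛-weaken (m≤n⊔m i j) q')

  -- GF ignores every finite prefix, in particular the positions before the threshold.
  GF-⇛ : ∀ {x y i₀} → x ⇛[ i₀ ] y → w ⊨ GF x → w ⊨ GF y
  GF-⇛ {x} {y} {i₀} (late q) (inj₁ GFx) = inj₁ λ k → F-at k (GFx (k + i₀))
    where
    F-at : ∀ k → suffix (k + i₀) w ⊨ F x → suffix k w ⊨ F y
    F-at k (j , xj , _) =
      i₀ + j ,
      q (≤-trans (m≤m+n i₀ j) (m≤n+m (i₀ + j) k)) (suffix-suffix w k (i₀ + j))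
        (⊨-resp-≗ x realign xj) ,
      λ _ _ → _
      where
      realign : suffix j (suffix (k + i₀) w) ≗ suffix (i₀ + j) (suffix k w)
      realign t = cong w (trans (+-assoc k i₀ (j + t)) (cong (k +_) (sym (+-assoc i₀ j t))))

  module _ (C : Formula n → Bool) where

    Faithful : Formula n → Set
    Faithful χ = ∀ {a} → InBasis χ (FG a) → Decides C w (FG a)

    Faithful-child : ∀ {a χ} → Child a χ → Faithful χ → Faithful a
    Faithful-child c d β = d (InBasis-mono (there here c) β)

    μ-≈ : ∀ χ → Faithful χ → χ ≈ μ⟨ C ⟩ χ
    μ-≈ tt d = ≈-refl
    μ-≈ ff d = ≈-refl
    μ-≈ (var a) d = ≈-refl
    μ-≈ (nvar a) d = ≈-refl
    μ-≈ (a ∧ b) d =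
      ≈-cong₂ ∧-⇛ ∧-⇛ (μ-≈ a (Faithful-child ∧ˡ d)) (μ-≈ b (Faithful-child ∧ʳ d))
    μ-≈ (a ∨ b) d =
      ≈-cong₂ ∨-⇛ ∨-⇛ (μ-≈ a (Faithful-child ∨ˡ d)) (μ-≈ b (Faithful-child ∨ʳ d))
    μ-≈ (X a) d = ≈-cong₁ X-⇛ X-⇛ (μ-≈ a (Faithful-child Xc d))
    μ-≈ (a U b) d =
      ≈-cong₂ U-⇛ U-⇛ (μ-≈ a (Faithful-child Uˡ d)) (μ-≈ b (Faithful-child Uʳ d))
    μ-≈ (a M b) d =
      ≈-cong₂ M-⇛ M-⇛ (μ-≈ a (Faithful-child Mˡ d)) (μ-≈ b (Faithful-child Mʳ d))
    μ-≈ (a W b) d with C (FG a) in e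
    ... | true = FG-entails⇒≈tt {a} (proj₁ (d (fgW here)) e) (G⊨W {a = a} {b})
    ... | false = ≈-cong₂ (W⇛U (proj₂ (d (fgW here)) e)) U⇛W
                    (μ-≈ a (Faithful-child Wˡ d)) (μ-≈ b (Faithful-child Wʳ d))
    μ-≈ (a R b) d with C (FG b) in e
    ... | true = FG-entails⇒≈tt {b} (proj₁ (d (fgR here)) e) (G⊨R {a = a} {b})
    ... | false = ≈-cong₂ (R⇛M (proj₂ (d (fgR here)) e)) M⇛R
                    (μ-≈ a (Faithful-child Rˡ d)) (μ-≈ b (Faithful-child Rʳ d))

  μ-mono : ∀ {C C'} → C ⊆ᵇᵇ C' → ∀ χ → μ⟨ C ⟩ χ ⇛[ 0 ] μ⟨ C' ⟩ χ
  μ-mono s tt = ⇛-refl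
  μ-mono s ff = ⇛-refl
  μ-mono s (var a) = ⇛-refl
  μ-mono s (nvar a) = ⇛-refl
  μ-mono s (a ∧ b) = ∧-⇛ (μ-mono s a) (μ-mono s b)
  μ-mono s (a ∨ b) = ∨-⇛ (μ-mono s a) (μ-mono s b)
  μ-mono s (X a) = X-⇛ (μ-mono s a)
  μ-mono s (a U b) = U-⇛ (μ-mono s a) (μ-mono s b)
  μ-mono s (a M b) = M-⇛ (μ-mono s a) (μ-mono s b)
  μ-mono {C} {C'} s (a W b) with C (FG a) in e
  ... | true rewrite s (FG a) e = ⇛-tt
  ... | false with C' (FG a)
  ...   | true = ⇛-tt
  ...   | false = U-⇛ (μ-mono s a) (μ-mono s b)
  μ-mono {C} {C'} s (a R b) with C (FG b) in e
  ... | true rewrite s (FG b) e = ⇛-tt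
  ... | false with C' (FG b)
  ...   | true = ⇛-tt
  ...   | false = M-⇛ (μ-mono s a) (μ-mono s b)

open Eventually using (μ-≈; μ-mono; GF-⇛)

proposition4p16 : ExcludedMiddle 0ℓ → {n : ℕ} → (φ ψ : Formula n) → InBasis φ (GF ψ)
    → (C : Formula n → Bool) → C ⊆ᵇ Below φ (GF ψ)
    → Δₕ 2 (GF (μ⟨ C ⟩ ψ))
      × EquivUnder C (Below φ (GF ψ)) (GF ψ) (GF (μ⟨ C ⟩ ψ))
      × ((C' : Formula n → Bool) → C ⊆ᵇᵇ C' → C' ⊆ᵇ Below φ (GF ψ)
          → GF (μ⟨ C ⟩ ψ) ⊨ᶠ GF (μ⟨ C' ⟩ ψ))
proposition4p16 _ φ ψ GFψ∈B C _ =
  GF-Σ₁-Δ₂ (μ-Σ₁ C ψ) , equivalent , λ C' C⊆C' _ w → GF-⇛ w (μ-mono w C⊆C' ψ)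
  where
  equivalent : EquivUnder C (Below φ (GF ψ)) (GF ψ) (GF (μ⟨ C ⟩ ψ))
  equivalent w ctx
    with μ-≈ w C ψ (λ β → InContext-decides ctx (FG-basis-below (GF-basis-∈sf GFψ∈B) β))
  ... | _ , ψ⇛μψ , μψ⇛ψ = GF-⇛ w ψ⇛μψ , GF-⇛ w μψ⇛ψ
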